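{- Let $q$ be an odd prime power, $n\ge2$, and let $\beta\in\mathbb{F}_{q^{2n}}^*$ have order $(q^n+1)(q-1)$; write $\Theta(a):x\mapsto ax$ and let $\gamma$ be a primitive element of $\mathbb{F}_{q^{2n}}$. Let $\mathcal{S}$ be a spread of $(\mathbb{F}_{q^{2n}},+)$ (as an $\mathbb{F}_q$-space) with kernel $\mathbb{F}_q$ such that $\mathrm{Aut}(\mathcal{S})\cap\langle\Theta(\gamma)\rangle$ contains $\langle\Theta(\beta^2)\rangle$, and let $W$ be a component of $\mathcal{S}$. If $\delta\in\mathbb{F}_{q^{2n}}$ satisfies $\delta^{q^n-1}=-1$, then $W\cap\mathbb{F}_{q^n}=\{0\}$ or $W\cap(\mathbb{F}_{q^n}\cdot\delta)=\{0\}$.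
   Context: A spread of the $2n$-dimensional $\mathbb{F}_q$-space $V=\mathbb{F}_{q^{2n}}$ is a set of $n$-dimensional $\mathbb{F}_q$-subspaces (components) partitioning the nonzero vectors. Its kernel is the subring of $\Gamma L(V)$ fixing every component; "kernel $\mathbb{F}_q$" means it consists exactly of scalar multiplications by $\mathbb{F}_q$. $\mathrm{Aut}(\mathcal{S})$ is the subgroup of $\Gamma L(V)$ permuting the components. -}

module Defs where

open import Level using (0ℓ)
open import Algebra.Bundles using (CommutativeRing)
open import Data.Nat as ℕ using (ℕ; zero; suc; _∸_; _≤_; _<_)
open import Data.Nat.Primality using (Prime)
open import Data.Fin as F using (Fin)
open import Data.Product using (Σ; ∃; ∃-syntax; _×_; _,_)
open import Data.Sum using (_⊎_)
open import Relation.Nullary using (¬_)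
open import Relation.Binary.PropositionalEquality using (_≡_)

OddPrimePower : ℕ → Set
OddPrimePower q = Σ ℕ λ p → Σ ℕ λ k → Prime p × ¬ (p ≡ 2) × 1 ≤ k × q ≡ p ℕ.^ k

module _ (R : CommutativeRing 0ℓ 0ℓ) where
  open CommutativeRing R

  pow : Carrier → ℕ → Carrier
  pow x zero = 1#
  pow x (suc m) = x * pow x m

  sumF : (m : ℕ) → (Fin m → Carrier) → Carrier
  sumF zero f = 0#
  sumF (suc m) f = f F.zero + sumF m (λ i → f (F.suc i))

  IsField : Set
  IsField = (1# ≉ 0#) × (∀ x → x ≉ 0# → ∃[ y ] (x * y ≈ 1#))

  HasCard : ℕ → Set
  HasCard N = Σ (Fin N → Carrier) λ e →
    (∀ i j → e i ≈ e j → i ≡ j) × (∀ x → ∃[ i ] (e i ≈ x))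

  HasOrder : Carrier → ℕ → Set
  HasOrder x m = 1 ≤ m × pow x m ≈ 1# × (∀ k → 1 ≤ k → k < m → pow x k ≉ 1#)

  -- the subfield F_{q^e} = { x | x^(q^e) = x }
  InSub : ℕ → Carrier → Set
  InSub Q x = pow x Q ≈ x

  Pred : Set₁
  Pred = Carrier → Set

  IsSubspace : ℕ → Pred → Set
  IsSubspace q W = (∀ (x y : Carrier) → x ≈ y → W x → W y) × W 0# ×
    (∀ (x y : Carrier) → W x → W y → W (x + y)) × (∀ (a x : Carrier) → InSub q a → W x → W (a * x))

  HasDim : ℕ → ℕ → Pred → Set
  HasDim q n W = IsSubspace q W × Σ (Fin n → Carrier) λ b →
    (∀ i → W (b i)) ×
    (∀ (c : Fin n → Carrier) → (∀ i → InSub q (c i)) → sumF n (λ i → c i * b i) ≈ 0# → ∀ i → c i ≈ 0#) ×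
    (∀ x → W x → Σ (Fin n → Carrier) λ c → (∀ i → InSub q (c i)) × x ≈ sumF n (λ i → c i * b i))

  SameSet : Pred → Pred → Set
  SameSet U W = ∀ x → (U x → W x) × (W x → U x)

  IsSpread : ℕ → ℕ → (I : Set) → (I → Pred) → Set
  IsSpread q n I comp = (∀ i → HasDim q n (comp i)) ×
    (∀ x → x ≉ 0# → ∃[ i ] comp i x) ×
    (∀ (x : Carrier) (i j : I) → x ≉ 0# → comp i x → comp j x → SameSet (comp i) (comp j))

  -- kernel of the spread is F_q: every additive endomorphism of (V,+)
  -- fixing every component is multiplication by a scalar of F_q
  KernelIsFq : ℕ → (I : Set) → (I → Pred) → Set
  KernelIsFq q I comp = ∀ (f : Carrier → Carrier) →
    (∀ x y → x ≈ y → f x ≈ f y) →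
    (∀ x y → f (x + y) ≈ f x + f y) →
    (∀ i x → comp i x → comp i (f x)) →
    ∃[ a ] (InSub q a × (∀ x → f x ≈ a * x))

  ImageMul : Carrier → Pred → Pred
  ImageMul a W y = ∃[ x ] (W x × y ≈ a * x)

  MulInAut : Carrier → (I : Set) → (I → Pred) → Set
  MulInAut a I comp = (∀ i → ∃[ j ] SameSet (ImageMul a (comp i)) (comp j)) ×
    (∀ j → ∃[ i ] SameSet (ImageMul a (comp i)) (comp j))

module Submission where

-- If W contained a nonzero x ∈ F_Q and a nonzero
-- u ∈ F_Q δ (so u ^ Q = - u), put c = (x + u) ^ (Q - 1).  Then c has norm
-- c ^ (Q + 1) = 1, so c is a power of β ^ (q - 1), an even power of β; and
-- Θ(c) maps x + u ∈ W to (x + u) ^ Q = x - u ∈ W, so Θ(c) stabilises W.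
-- Multiplying out the Q - 1 nonzero vectors of W then gives c ^ (Q - 1) = 1,
-- hence c = ±1, i.e. u = 0 or x = 0.

open import Level using (0ℓ)
open import Algebra.Bundles using (CommutativeRing)
open import Defs
open import Data.Nat using (ℕ; suc)
import Data.Nat as Nat
open import Data.Nat.Primality using (Prime)
open import Relation.Binary.PropositionalEquality using (_≡_)

module Counting where

  open import Data.Nat using (ℕ; zero; suc)
  open import Data.Nat.Properties using (1+n≰n)
  open import Data.Fin using (Fin; punchOut)
  open import Data.Fin.Properties using (any?; _≟_; punchOut-injective; injective⇒≤)
  open import Data.Fin.Permutation using (Permutation; permutation)
  open import Data.Product using (∃-syntax; _,_; proj₁; proj₂)
  open import Data.Empty using (⊥-elim)
  open import Relation.Nullary using (yes; no)
  open import Relation.Binary.PropositionalEquality as Eq using (_≡_; _≢_)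
  open import Algebra.Bundles using (CommutativeMonoid)

  injective⇒surjective : ∀ {m} (f : Fin m → Fin m) → (∀ i j → f i ≡ f j → i ≡ j) →
    ∀ j → ∃[ i ] (f i ≡ j)
  injective⇒surjective {zero} f inj ()
  injective⇒surjective {suc m} f inj j with any? (λ i → f i ≟ j)
  ... | yes hit = hit
  ... | no miss = ⊥-elim (1+n≰n (injective⇒≤ {f = squeeze} squeeze-injective))
    where
    -- f misses j, so it factors through the m-element set Fin (suc m) ∖ {j}
    avoids : ∀ i → j ≢ f i
    avoids i e = miss (i , Eq.sym e)
    squeeze : Fin (suc m) → Fin m
    squeeze i = punchOut (avoids i)
    squeeze-injective : ∀ {a b} → squeeze a ≡ squeeze b → a ≡ b
    squeeze-injective {a} {b} e = inj a b (punchOut-injective (avoids a) (avoids b) e)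

  module InvariantSum {c ℓ} (M : CommutativeMonoid c ℓ) where
    open CommutativeMonoid M
    open import Algebra.Properties.CommutativeMonoid.Sum M using (sum; sum-permute; sum-cong-≋)

    sum-invariant : ∀ {p} (m : ℕ) (e : Fin m → Carrier) (P : Carrier → Set p) →
      (∀ i → P (e i)) → (∀ i j → e i ≈ e j → i ≡ j) → (∀ z → P z → ∃[ i ] (e i ≈ z)) →
      (g : Carrier → Carrier) → (∀ z → P z → P (g z)) → (∀ z z' → g z ≈ g z' → z ≈ z') →
      sum e ≈ sum (λ i → g (e i))
    sum-invariant m e P e∈P e-inj e-onto g g-maps g-inj =
      trans (sum-permute e π) (sum-cong-≋ λ i → proj₂ (preimage i))
      where
      preimage : ∀ i → ∃[ j ] (e j ≈ g (e i))
      preimage i = e-onto (g (e i)) (g-maps _ (e∈P i))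
      h : Fin m → Fin m
      h i = proj₁ (preimage i)
      h-inj : ∀ i j → h i ≡ h j → i ≡ j
      h-inj i j eq = e-inj i j (g-inj _ _
        (trans (sym (proj₂ (preimage i))) (trans (reflexive (Eq.cong e eq)) (proj₂ (preimage j)))))
      h-onto = injective⇒surjective h h-inj
      π : Permutation m m
      π = permutation h (λ j → proj₁ (h-onto j)) (λ j → proj₂ (h-onto j))
        (λ i → h-inj _ _ (proj₂ (h-onto (h i))))

module Arithmetic where

  open import Data.Nat using (zero; suc; _+_; _*_; _^_; _<_; s≤s; z≤n)
  import Data.Nat.Properties as ℕₚ
  open import Data.Nat.Combinatorics using (_C_; nC1≡n; k>n⇒nCk≡0; nCk+nC[k+1]≡[n+1]C[k+1])
  open import Data.Nat.Divisibility using (_∣_; divides)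
  open import Data.Nat.Coprimality using (prime⇒coprime; coprime-divisor)
  open import Data.Nat.Primality using (Prime; prime⇒irreducible)
  open import Data.Nat.Tactic.RingSolver using (solve-∀)
  open import Data.Product using (∃-syntax; _,_)
  open import Data.Sum using (_⊎_; inj₁; inj₂)
  open import Data.Empty using (⊥-elim)
  open import Relation.Nullary using (¬_)
  open import Relation.Binary.PropositionalEquality
  open ≡-Reasoning

  absorption : ∀ n k → suc k * (suc n C suc k) ≡ suc n * (n C k)
  absorption zero zero = refl
  absorption zero (suc k) = begin
    suc (suc k) * (1 C suc (suc k)) ≡⟨ cong (suc (suc k) *_) (k>n⇒nCk≡0 {1} {suc (suc k)} (s≤s (s≤s z≤n))) ⟩
    suc (suc k) * 0                 ≡⟨ ℕₚ.*-zeroʳ (suc (suc k)) ⟩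
    0                               ≡⟨ cong (1 *_) (sym (k>n⇒nCk≡0 {0} {suc k} (s≤s z≤n))) ⟩
    1 * (0 C suc k)                 ∎
  absorption (suc n) zero = begin
    1 * (suc (suc n) C 1) ≡⟨ ℕₚ.*-identityˡ _ ⟩
    suc (suc n) C 1       ≡⟨ nC1≡n (suc (suc n)) ⟩
    suc (suc n)           ≡⟨ sym (ℕₚ.*-identityʳ _) ⟩
    suc (suc n) * 1       ∎
  absorption (suc n) (suc k) = begin
    suc (suc k) * (suc (suc n) C suc (suc k)) ≡⟨ cong (suc (suc k) *_) (sym (nCk+nC[k+1]≡[n+1]C[k+1] (suc n) (suc k))) ⟩
    suc (suc k) * (a + b)                     ≡⟨ ℕₚ.*-distribˡ-+ (suc (suc k)) a b ⟩
    suc (suc k) * a + suc (suc k) * b         ≡⟨ cong₂ (λ s t → (a + s) + t) (absorption n k) (absorption n (suc k)) ⟩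
    (a + suc n * c) + suc n * d               ≡⟨ ℕₚ.+-assoc a _ _ ⟩
    a + (suc n * c + suc n * d)               ≡⟨ cong (a +_) (sym (ℕₚ.*-distribˡ-+ (suc n) c d)) ⟩
    a + suc n * (c + d)                       ≡⟨ cong (λ t → a + suc n * t) (nCk+nC[k+1]≡[n+1]C[k+1] n k) ⟩
    suc (suc n) * a                           ∎
    where
    a = suc n C suc k
    b = suc n C suc (suc k)
    c = n C k
    d = n C suc k

  prime∣binomial : ∀ p k → Prime p → 0 < k → k < p → p ∣ (p C k)
  prime∣binomial (suc p₁) (suc k₁) p-prime _ k<p =
    coprime-divisor (prime⇒coprime p-prime k<p)
      (divides (p₁ C k₁) (trans (absorption p₁ k₁) (ℕₚ.*-comm (suc p₁) _)))

  parity : ∀ m → ∃[ h ] (m ≡ h + h ⊎ m ≡ suc (h + h))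
  parity zero = 0 , inj₁ refl
  parity (suc m) with parity m
  ... | h , inj₁ eq = h , inj₂ (cong suc eq)
  ... | h , inj₂ eq = suc h , inj₁ (cong suc (trans eq (sym (ℕₚ.+-suc h h))))

  odd-prime : ∀ p → Prime p → ¬ (p ≡ 2) → ∃[ e ] (p ≡ suc (e + e))
  odd-prime p p-prime p≢2 with parity p
  ... | h , inj₂ eq = h , eq
  ... | h , inj₁ eq with prime⇒irreducible p-prime (divides h (trans eq (double h)))
    where
    double : ∀ h → h + h ≡ h * 2
    double = solve-∀
  ...   | inj₁ ()
  ...   | inj₂ 2≡p = ⊥-elim (p≢2 (sym 2≡p))

  odd-power : ∀ e k → ∃[ f ] (suc (e + e) ^ k ≡ suc (f + f))
  odd-power e zero = 0 , refl
  odd-power e (suc k) with odd-power e k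
  ... | f , eq = e + f + e * f + e * f , trans (cong (suc (e + e) *_) eq) (product-odd e f)
    where
    product-odd : ∀ e f → suc (e + e) * suc (f + f) ≡ suc ((e + f + e * f + e * f) + (e + f + e * f + e * f))
    product-odd = solve-∀

  geometric : ∀ q₁ m → ∃[ G ] (suc q₁ ^ m ≡ suc (q₁ * G))
  geometric q₁ zero = 0 , cong suc (sym (ℕₚ.*-zeroʳ q₁))
  geometric q₁ (suc m) with geometric q₁ m
  ... | G , eq = suc (suc q₁ * G) , trans (cong (suc q₁ *_) eq) (step q₁ G)
    where
    step : ∀ q₁ G → suc q₁ * suc (q₁ * G) ≡ suc (q₁ * suc (suc q₁ * G))
    step = solve-∀

  square-power : ∀ q n Q₁ → q ^ n ≡ suc Q₁ → q ^ (2 * n) ≡ suc (Q₁ * suc (suc Q₁))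
  square-power q n Q₁ q^n≡Q = begin
    q ^ (2 * n)       ≡⟨ cong (q ^_) (twice n) ⟩
    q ^ (n + n)       ≡⟨ ℕₚ.^-distribˡ-+-* q n n ⟩
    q ^ n * q ^ n     ≡⟨ cong₂ _*_ q^n≡Q q^n≡Q ⟩
    suc Q₁ * suc Q₁   ≡⟨ square Q₁ ⟩
    suc (Q₁ * suc (suc Q₁)) ∎
    where
    twice : ∀ n → 2 * n ≡ n + n
    twice = solve-∀
    square : ∀ Q₁ → suc Q₁ * suc Q₁ ≡ suc (Q₁ * suc (suc Q₁))
    square = solve-∀

module RingFacts (R : CommutativeRing 0ℓ 0ℓ) where

  open CommutativeRing R
  open import Relation.Binary.Reasoning.Setoid setoid
  open import Algebra.Properties.Semiring.Exp semiring using (_^_; ^-homo-*; ^-assocʳ; ^-congˡ)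
  open import Algebra.Properties.CommutativeSemiring.Exp commutativeSemiring using (^-distrib-*)
  open import Algebra.Properties.Ring ring using (-‿+-comm; +-inverseˡ-unique)
  open import Algebra.Properties.CommutativeSemigroup +-commutativeSemigroup using (interchange)
  open import Data.Nat as ℕ using (ℕ; zero; suc)
  import Data.Nat.Properties as ℕₚ
  open import Data.Fin as F using (Fin)
  import Relation.Binary.PropositionalEquality as Eq

  pow≡^ : ∀ x m → pow R x m Eq.≡ x ^ m
  pow≡^ x zero = Eq.refl
  pow≡^ x (suc m) = Eq.cong (x *_) (pow≡^ x m)

  pow-cong : ∀ {x y} m → x ≈ y → pow R x m ≈ pow R y m
  pow-cong {x} {y} m x≈y = begin
    pow R x m ≡⟨ pow≡^ x m ⟩
    x ^ m     ≈⟨ ^-congˡ m x≈y ⟩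
    y ^ m     ≡⟨ pow≡^ y m ⟨
    pow R y m ∎

  pow-+ : ∀ x a b → pow R x (a ℕ.+ b) ≈ pow R x a * pow R x b
  pow-+ x a b = begin
    pow R x (a ℕ.+ b)     ≡⟨ pow≡^ x (a ℕ.+ b) ⟩
    x ^ (a ℕ.+ b)         ≈⟨ ^-homo-* x a b ⟩
    x ^ a * x ^ b         ≡⟨ Eq.cong₂ _*_ (pow≡^ x a) (pow≡^ x b) ⟨
    pow R x a * pow R x b ∎

  pow-* : ∀ x a b → pow R x (a ℕ.* b) ≈ pow R (pow R x a) b
  pow-* x a b = begin
    pow R x (a ℕ.* b)     ≡⟨ pow≡^ x (a ℕ.* b) ⟩
    x ^ (a ℕ.* b)         ≈⟨ ^-assocʳ x a b ⟨
    (x ^ a) ^ b           ≡⟨ Eq.trans (pow≡^ (pow R x a) b) (Eq.cong (_^ b) (pow≡^ x a)) ⟨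
    pow R (pow R x a) b   ∎

  pow-distrib : ∀ x y a → pow R (x * y) a ≈ pow R x a * pow R y a
  pow-distrib x y a = begin
    pow R (x * y) a       ≡⟨ pow≡^ (x * y) a ⟩
    (x * y) ^ a           ≈⟨ ^-distrib-* x y a ⟩
    x ^ a * y ^ a         ≡⟨ Eq.cong₂ _*_ (pow≡^ x a) (pow≡^ y a) ⟨
    pow R x a * pow R y a ∎

  pow-1# : ∀ a → pow R 1# a ≈ 1#
  pow-1# zero = refl
  pow-1# (suc a) = trans (*-identityˡ _) (pow-1# a)

  pow-0# : ∀ a → pow R 0# (suc a) ≈ 0#
  pow-0# a = zeroˡ _

  pow-multiple : ∀ x m k → pow R x m ≈ 1# → pow R x (k ℕ.* m) ≈ 1#
  pow-multiple x m k xm≈1 = begin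
    pow R x (k ℕ.* m)   ≡⟨ Eq.cong (pow R x) (ℕₚ.*-comm k m) ⟩
    pow R x (m ℕ.* k)   ≈⟨ pow-* x m k ⟩
    pow R (pow R x m) k ≈⟨ pow-cong k xm≈1 ⟩
    pow R 1# k          ≈⟨ pow-1# k ⟩
    1#                  ∎

  sumF-cong : ∀ m {f g : Fin m → Carrier} → (∀ i → f i ≈ g i) → sumF R m f ≈ sumF R m g
  sumF-cong zero f≈g = refl
  sumF-cong (suc m) f≈g = +-cong (f≈g F.zero) (sumF-cong m (λ i → f≈g (F.suc i)))

  sumF-sub : ∀ m (f g : Fin m → Carrier) → sumF R m f - sumF R m g ≈ sumF R m (λ i → f i - g i)
  sumF-sub zero f g = -‿inverseʳ 0#
  sumF-sub (suc m) f g = begin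
    (f F.zero + Σf) - (g F.zero + Σg)       ≈⟨ +-congˡ (-‿+-comm _ _) ⟨
    (f F.zero + Σf) + (- g F.zero + - Σg)   ≈⟨ interchange _ _ _ _ ⟩
    (f F.zero - g F.zero) + (Σf - Σg)       ≈⟨ +-congˡ (sumF-sub m _ _) ⟩
    sumF R (suc m) (λ i → f i - g i)        ∎
    where
    Σf = sumF R m (λ i → f (F.suc i))
    Σg = sumF R m (λ i → g (F.suc i))

  Additive : ℕ → Set
  Additive e = ∀ x y → pow R (x + y) e ≈ pow R x e + pow R y e

  additive-neg : ∀ e .{{_ : ℕ.NonZero e}} → Additive e → ∀ x → pow R (- x) e ≈ - pow R x e
  additive-neg e@(suc e₁) additive x = +-inverseˡ-unique _ _ (begin
    pow R (- x) e + pow R x e  ≈⟨ additive (- x) x ⟨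
    pow R (- x + x) e          ≈⟨ pow-cong e (-‿inverseˡ x) ⟩
    pow R 0# e                 ≈⟨ pow-0# e₁ ⟩
    0#                         ∎)

  additive-sub : ∀ e .{{_ : ℕ.NonZero e}} → Additive e → ∀ a b → InSub R e a → InSub R e b → InSub R e (a - b)
  additive-sub e additive a b a∈ b∈ =
    trans (additive a (- b)) (+-cong a∈ (trans (additive-neg e additive b) (-‿cong b∈)))

  open import Algebra.Properties.Semiring.Mult semiring using (_×_; ×-assoc-*; ×-congʳ)

  module Characteristic (p : ℕ) (p-prime : Prime p) (char-p : p × 1# ≈ 0#) where
    open import Algebra.Properties.Monoid.Mult +-monoid using (×-assocˡ)
    open import Algebra.Properties.CommutativeSemiring.Binomial commutativeSemiring using (theorem; binomialExpansion)
    open import Algebra.Properties.CommutativeMonoid.Sum +-commutativeMonoid using (sum; sum-cong-≋; sum-replicate-zero; sum-init-last)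
    open import Data.Nat.Combinatorics using (_C_; nCn≡1)
    open import Data.Nat.Divisibility using (_∣_; divides)
    open import Data.Nat using (_∸_; _<_; s≤s; z≤n)
    import Data.Fin.Properties as Fₚ
    open Arithmetic using (prime∣binomial)

    ×-zeroʳ : ∀ m → m × 0# ≈ 0#
    ×-zeroʳ zero = refl
    ×-zeroʳ (suc m) = trans (+-identityˡ _) (×-zeroʳ m)

    p×≈0 : ∀ z → p × z ≈ 0#
    p×≈0 z = begin
      p × z        ≈⟨ ×-congʳ p (*-identityˡ z) ⟨
      p × (1# * z) ≈⟨ ×-assoc-* p 1# z ⟨
      (p × 1#) * z ≈⟨ *-congʳ char-p ⟩
      0# * z       ≈⟨ zeroˡ z ⟩
      0#           ∎

    multiple-of-p× : ∀ c z → p ∣ c → c × z ≈ 0#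
    multiple-of-p× c z (divides m Eq.refl) = begin
      (m ℕ.* p) × z   ≈⟨ ×-assocˡ z m p ⟨
      m × (p × z)     ≈⟨ ×-congʳ m (p×≈0 z) ⟩
      m × 0#          ≈⟨ ×-zeroʳ m ⟩
      0#              ∎

    -- (x + y) ^ p ≈ x ^ p + y ^ p: the inner binomial coefficients vanish
    frobenius : ∀ x y → pow R (x + y) p ≈ pow R x p + pow R y p
    frobenius x y = expand p p-prime Eq.refl
      where
      term : ℕ → Carrier
      term j = (p C j) × (x ^ j * y ^ (p ∸ j))
      -- split off the first and last terms, which needs p ≥ 2
      expand : ∀ p' → Prime p' → p' Eq.≡ p → pow R (x + y) p ≈ pow R x p + pow R y p
      expand (suc (suc p₂)) _ Eq.refl = begin
        pow R (x + y) p                                 ≡⟨ pow≡^ _ p ⟩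
        (x + y) ^ p                                     ≈⟨ theorem p x y ⟩
        binomialExpansion x y p                         ≡⟨⟩
        t F.zero + sum (λ i → t (F.suc i))              ≈⟨ +-congˡ (sum-init-last (λ i → t (F.suc i))) ⟩
        t F.zero + (sum inner + t (F.suc (F.fromℕ p₁))) ≈⟨ +-congˡ (+-congʳ (trans (sum-cong-≋ inner≈0) (sum-replicate-zero p₁))) ⟩
        t F.zero + (0# + t (F.suc (F.fromℕ p₁)))        ≈⟨ +-congˡ (+-identityˡ _) ⟩
        t F.zero + term (suc (F.toℕ (F.fromℕ p₁)))      ≡⟨ Eq.cong (λ j → t F.zero + term (suc j)) (Fₚ.toℕ-fromℕ p₁) ⟩
        t F.zero + term p                               ≈⟨ +-comm _ _ ⟩
        term p + t F.zero                               ≈⟨ +-cong last≈x^p first≈y^p ⟩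
        x ^ p + y ^ p                                   ≡⟨ Eq.cong₂ _+_ (pow≡^ x p) (pow≡^ y p) ⟨
        pow R x p + pow R y p                           ∎
        where
        p₁ = suc p₂
        t : Fin (suc p) → Carrier
        t k = term (F.toℕ k)
        inner : Fin p₁ → Carrier
        inner i = t (F.suc (F.inject₁ i))
        inner≈0 : ∀ i → inner i ≈ 0#
        inner≈0 i = multiple-of-p× _ _ (prime∣binomial p (suc (F.toℕ (F.inject₁ i))) p-prime (s≤s z≤n)
          (s≤s (Eq.subst (_< p₁) (Eq.sym (Fₚ.toℕ-inject₁ i)) (Fₚ.toℕ<n i))))
        first≈y^p : t F.zero ≈ y ^ p
        first≈y^p = trans (+-identityʳ _) (*-identityˡ _)
        last≈x^p : term p ≈ x ^ p
        last≈x^p = begin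
          (p C p) × (x ^ p * y ^ (p ∸ p)) ≡⟨ Eq.cong₂ (λ a b → a × (x ^ p * y ^ b)) (nCn≡1 p) (ℕₚ.n∸n≡0 p) ⟩
          1 × (x ^ p * 1#)               ≈⟨ +-identityʳ _ ⟩
          x ^ p * 1#                     ≈⟨ *-identityʳ _ ⟩
          x ^ p                          ∎

    frobenius^ : ∀ m → Additive (p ℕ.^ m)
    frobenius^ zero x y = trans (*-identityʳ _) (sym (+-cong (*-identityʳ x) (*-identityʳ y)))
    frobenius^ (suc m) x y = begin
      pow R (x + y) (p ℕ.* p ℕ.^ m)                           ≈⟨ pow-* (x + y) p (p ℕ.^ m) ⟩
      pow R (pow R (x + y) p) (p ℕ.^ m)                       ≈⟨ pow-cong (p ℕ.^ m) (frobenius x y) ⟩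
      pow R (pow R x p + pow R y p) (p ℕ.^ m)                 ≈⟨ frobenius^ m _ _ ⟩
      pow R (pow R x p) (p ℕ.^ m) + pow R (pow R y p) (p ℕ.^ m) ≈⟨ +-cong (pow-* x p _) (pow-* y p _) ⟨
      pow R x (p ℕ.* p ℕ.^ m) + pow R y (p ℕ.* p ℕ.^ m)       ∎

    -- for p = 2e + 1, x = p · x - e · (x + x)
    double≈0 : ∀ e → p Eq.≡ suc (e ℕ.+ e) → ∀ x → x + x ≈ 0# → x ≈ 0#
    double≈0 e p-odd x x+x≈0 = begin
      x                     ≈⟨ +-identityʳ x ⟨
      x + 0#                ≈⟨ +-congˡ (doubles e) ⟨
      x + (e ℕ.+ e) × x     ≡⟨⟩
      suc (e ℕ.+ e) × x     ≡⟨ Eq.cong (_× x) p-odd ⟨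
      p × x                 ≈⟨ p×≈0 x ⟩
      0#                    ∎
      where
      doubles : ∀ m → (m ℕ.+ m) × x ≈ 0#
      doubles zero = refl
      doubles (suc m) = begin
        x + (m ℕ.+ suc m) × x   ≡⟨ Eq.cong (λ t → x + t × x) (ℕₚ.+-suc m m) ⟩
        x + (x + (m ℕ.+ m) × x) ≈⟨ +-assoc x x _ ⟨
        (x + x) + (m ℕ.+ m) × x ≈⟨ +-cong x+x≈0 (doubles m) ⟩
        0# + 0#                 ≈⟨ +-identityʳ 0# ⟩
        0#                      ∎

module Enumerations (R : CommutativeRing 0ℓ 0ℓ) where

  open CommutativeRing R
  open import Data.Nat using (ℕ; suc)
  open import Data.Fin as F using (Fin)
  import Data.Fin.Properties as Fₚ
  open import Data.Product using (∃-syntax; _×_; _,_; proj₁; proj₂)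
  import Relation.Binary.PropositionalEquality as Eq

  record Enumerates (N : ℕ) (S : Pred R) : Set where
    field
      elem : Fin N → Carrier
      elem∈ : ∀ i → S (elem i)
      elem-injective : ∀ i j → elem i ≈ elem j → i Eq.≡ j
      elem-onto : ∀ z → S z → ∃[ i ] (elem i ≈ z)

  remove-zero : ∀ {m S} → Enumerates (suc m) S → S 0# → Enumerates m (λ z → S z × z ≉ 0#)
  remove-zero {m} {S} E S0 = record
    { elem = λ j → elem (F.punchIn i₀ j)
    ; elem∈ = λ j → elem∈ _ , λ e≈0 → Fₚ.punchInᵢ≢i i₀ j (elem-injective _ _ (trans e≈0 (sym elem-i₀≈0)))
    ; elem-injective = λ j j' e → Fₚ.punchIn-injective i₀ j j' (elem-injective _ _ e)
    ; elem-onto = onto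
    }
    where
    open Enumerates E
    i₀ = proj₁ (elem-onto 0# S0)
    elem-i₀≈0 : elem i₀ ≈ 0#
    elem-i₀≈0 = proj₂ (elem-onto 0# S0)
    onto : ∀ z → S z × z ≉ 0# → ∃[ j ] (elem (F.punchIn i₀ j) ≈ z)
    onto z (Sz , z≉0) = F.punchOut i₀≢i , trans (reflexive (Eq.cong elem (Fₚ.punchIn-punchOut i₀≢i))) (proj₂ (elem-onto z Sz))
      where
      i₀≢i : i₀ Eq.≢ proj₁ (elem-onto z Sz)
      i₀≢i eq = z≉0 (trans (sym (proj₂ (elem-onto z Sz))) (trans (reflexive (Eq.cong elem (Eq.sym eq))) elem-i₀≈0))

  injective⇒onto : ∀ {m S} → Enumerates m S → (f : Fin m → Carrier) → (∀ i → S (f i)) →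
    (∀ i j → f i ≈ f j → i Eq.≡ j) → ∀ z → S z → ∃[ i ] (f i ≈ z)
  injective⇒onto {m} {S} E f f∈S f-injective z Sz =
    proj₁ hit , trans (sym (index≈ (proj₁ hit))) (trans (reflexive (Eq.cong elem (proj₂ hit))) (proj₂ (elem-onto z Sz)))
    where
    open Enumerates E
    index : Fin m → Fin m
    index i = proj₁ (elem-onto (f i) (f∈S i))
    index≈ : ∀ i → elem (index i) ≈ f i
    index≈ i = proj₂ (elem-onto (f i) (f∈S i))
    index-injective : ∀ i j → index i Eq.≡ index j → i Eq.≡ j
    index-injective i j eq = f-injective i j (trans (sym (index≈ i)) (trans (reflexive (Eq.cong elem eq)) (index≈ j)))
    hit = Counting.injective⇒surjective index index-injective (proj₁ (elem-onto z Sz))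

module FieldFacts (R : CommutativeRing 0ℓ 0ℓ) (field-R : IsField R) where

  open CommutativeRing R
  open RingFacts R
  open import Relation.Binary.Reasoning.Setoid setoid
  open import Data.Nat as ℕ using (zero; suc; _≤_; _<_; z≤n; s≤s; _∸_)
  import Data.Nat.Properties as ℕₚ
  open import Data.Nat.DivMod using (_/_; _%_; m≡m%n+[m/n]*n; m%n<n)
  open import Data.Nat.Divisibility using (_∣_; divides)
  open import Data.Fin as F using (Fin)
  open import Data.Product using (∃-syntax; _,_; proj₁; proj₂)
  open import Data.Sum using (inj₁; inj₂)
  open import Data.Empty using (⊥-elim)
  import Relation.Binary.PropositionalEquality as Eq

  1≉0 : 1# ≉ 0#
  1≉0 = proj₁ field-R

  cancel : ∀ x {y z} → x ≉ 0# → x * y ≈ x * z → y ≈ z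
  cancel x {y} {z} x≉0 xy≈xz = begin
    y               ≈⟨ *-identityˡ y ⟨
    1# * y          ≈⟨ *-congʳ x⁻¹x≈1 ⟨
    (x⁻¹ * x) * y   ≈⟨ *-assoc _ _ _ ⟩
    x⁻¹ * (x * y)   ≈⟨ *-congˡ xy≈xz ⟩
    x⁻¹ * (x * z)   ≈⟨ *-assoc _ _ _ ⟨
    (x⁻¹ * x) * z   ≈⟨ *-congʳ x⁻¹x≈1 ⟩
    1# * z          ≈⟨ *-identityˡ z ⟩
    z               ∎
    where
    x⁻¹ = proj₁ (proj₂ field-R x x≉0)
    x⁻¹x≈1 : x⁻¹ * x ≈ 1#
    x⁻¹x≈1 = trans (*-comm _ _) (proj₂ (proj₂ field-R x x≉0))

  *-nonzero : ∀ {x y} → x ≉ 0# → y ≉ 0# → x * y ≉ 0#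
  *-nonzero {x} x≉0 y≉0 xy≈0 = y≉0 (cancel x x≉0 (trans xy≈0 (sym (zeroʳ x))))

  pow-nonzero : ∀ {x} m → x ≉ 0# → pow R x m ≉ 0#
  pow-nonzero zero x≉0 = 1≉0
  pow-nonzero (suc m) x≉0 = *-nonzero x≉0 (pow-nonzero m x≉0)

  root-of-unity-nonzero : ∀ {x} m .{{_ : ℕ.NonZero m}} → pow R x m ≈ 1# → x ≉ 0#
  root-of-unity-nonzero (suc m) x^m≈1 x≈0 = 1≉0 (trans (sym x^m≈1) (trans (*-congʳ x≈0) (zeroˡ _)))

  order-nonzero : ∀ {x m} → HasOrder R x m → x ≉ 0#
  order-nonzero {x} {m} (1≤m , x^m≈1 , _) = root-of-unity-nonzero m {{ℕ.>-nonZero 1≤m}} x^m≈1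

  order-divides : ∀ {x m} e → HasOrder R x m → pow R x e ≈ 1# → m ∣ e
  order-divides {x} {suc m} e (_ , x^m≈1 , minimal) x^e≈1 with e % suc m in rem
  ... | zero = divides (e / suc m) (Eq.trans (m≡m%n+[m/n]*n e (suc m)) (Eq.cong (ℕ._+ (e / suc m) ℕ.* suc m) rem))
  ... | suc r = ⊥-elim (minimal (suc r) (s≤s z≤n) (Eq.subst (_< suc m) rem (m%n<n e (suc m))) x^rem≈1)
    where
    x^rem≈1 : pow R x (suc r) ≈ 1#
    x^rem≈1 = begin
      pow R x (suc r)                                      ≈⟨ *-identityʳ _ ⟨
      pow R x (suc r) * 1#                                 ≈⟨ *-congˡ (pow-multiple x (suc m) (e / suc m) x^m≈1) ⟨
      pow R x (suc r) * pow R x ((e / suc m) ℕ.* suc m)   ≈⟨ pow-+ x (suc r) _ ⟨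
      pow R x (suc r ℕ.+ (e / suc m) ℕ.* suc m)            ≡⟨ Eq.cong (λ t → pow R x (t ℕ.+ (e / suc m) ℕ.* suc m)) rem ⟨
      pow R x (e % suc m ℕ.+ (e / suc m) ℕ.* suc m)        ≡⟨ Eq.cong (pow R x) (m≡m%n+[m/n]*n e (suc m)) ⟨
      pow R x e                                            ≈⟨ x^e≈1 ⟩
      1#                                                   ∎

  pow-injective-≤ : ∀ {x m i j} → HasOrder R x m → i ≤ j → j < m → pow R x i ≈ pow R x j → i Eq.≡ j
  pow-injective-≤ {x} {m} {i} {j} ord@(_ , _ , minimal) i≤j j<m xi≈xj with j ∸ i in gap
  ... | zero = ℕₚ.≤-antisym i≤j (ℕₚ.m∸n≡0⇒m≤n gap)
  ... | suc d = ⊥-elim (minimal (suc d) (s≤s z≤n) gap<m x^gap≈1)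
    where
    gap<m : suc d < m
    gap<m = ℕₚ.≤-<-trans (ℕₚ.≤-trans (ℕₚ.≤-reflexive (Eq.sym gap)) (ℕₚ.m∸n≤m j i)) j<m
    x^gap≈1 : pow R x (suc d) ≈ 1#
    x^gap≈1 = cancel (pow R x i) (pow-nonzero i (order-nonzero ord)) (begin
      pow R x i * pow R x (suc d) ≈⟨ pow-+ x i (suc d) ⟨
      pow R x (i ℕ.+ suc d)       ≡⟨ Eq.cong (λ t → pow R x (i ℕ.+ t)) gap ⟨
      pow R x (i ℕ.+ (j ∸ i))     ≡⟨ Eq.cong (pow R x) (ℕₚ.m+[n∸m]≡n i≤j) ⟩
      pow R x j                   ≈⟨ xi≈xj ⟨
      pow R x i                   ≈⟨ *-identityʳ _ ⟨
      pow R x i * 1#              ∎)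

  pow-injective : ∀ {x m i j} → HasOrder R x m → i < m → j < m → pow R x i ≈ pow R x j → i Eq.≡ j
  pow-injective ord i<m j<m xi≈xj with ℕₚ.≤-total _ _
  ... | inj₁ i≤j = pow-injective-≤ ord i≤j j<m xi≈xj
  ... | inj₂ j≤i = Eq.sym (pow-injective-≤ ord j≤i i<m (sym xi≈xj))

  order-of-power : ∀ {x} d m → HasOrder R x (d ℕ.* m) → HasOrder R (pow R x m) d
  order-of-power {x} d m (1≤dm , x^dm≈1 , minimal) =
    ℕ.>-nonZero⁻¹ d , power≈1 , power-minimal
    where
    instance
      dm-nonzero : ℕ.NonZero (d ℕ.* m)
      dm-nonzero = ℕ.>-nonZero 1≤dm
      d-nonzero : ℕ.NonZero d
      d-nonzero = ℕₚ.m*n≢0⇒m≢0 d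
      m-nonzero : ℕ.NonZero m
      m-nonzero = ℕₚ.m*n≢0⇒n≢0 d
    power≈1 : pow R (pow R x m) d ≈ 1#
    power≈1 = trans (sym (pow-* x m d)) (trans (reflexive (Eq.cong (pow R x) (ℕₚ.*-comm m d))) x^dm≈1)
    power-minimal : ∀ k → 1 ≤ k → k < d → pow R (pow R x m) k ≉ 1#
    power-minimal k 1≤k k<d x^mk≈1 = minimal (m ℕ.* k) (ℕ.>-nonZero⁻¹ (m ℕ.* k) {{ℕₚ.m*n≢0 m k {{m-nonzero}} {{ℕ.>-nonZero 1≤k}}}})
      (Eq.subst (m ℕ.* k <_) (ℕₚ.*-comm m d) (ℕₚ.*-monoʳ-< m k<d)) (trans (pow-* x m k) x^mk≈1)

  open Enumerations R

  -- If c ≠ 0 maps a set S ∋ 0 of m + 1 elements into itself, then c ^ m ≈ 1: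
  -- multiplying the product of the m nonzero elements of S by c permutes them.
  stabiliser-order : ∀ {S} m → Enumerates (suc m) S → S 0# →
    ∀ c → c ≉ 0# → (∀ z → S z → S (c * z)) → pow R c m ≈ 1#
  stabiliser-order {S} m E S0 c c≉0 c-maps = cancel (prod e) prod≉0 (begin
    prod e * pow R c m               ≈⟨ *-comm _ _ ⟩
    pow R c m * prod e               ≈⟨ *-congʳ (constant-product m) ⟨
    prod {m} (λ _ → c) * prod e      ≈⟨ ∑-distrib-+ (λ _ → c) e ⟨
    prod (λ j → c * e j)             ≈⟨ sum-invariant m e _ elem∈ elem-injective elem-onto (c *_)
                                          (λ z (Sz , z≉0) → c-maps z Sz , *-nonzero c≉0 z≉0) (λ z z' → cancel c c≉0) ⟨
    prod e                           ≈⟨ *-identityʳ _ ⟨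
    prod e * 1#                      ∎)
    where
    open import Algebra.Properties.CommutativeMonoid.Sum *-commutativeMonoid using (∑-distrib-+) renaming (sum to prod)
    open Counting.InvariantSum *-commutativeMonoid using (sum-invariant)
    open Enumerates (remove-zero E S0) renaming (elem to e)
    constant-product : ∀ k → prod {k} (λ _ → c) ≈ pow R c k
    constant-product zero = refl
    constant-product (suc k) = *-congˡ (constant-product k)
    prod≉0 : prod e ≉ 0#
    prod≉0 = nonzero-product m (λ j → proj₂ (elem∈ j))
      where
      nonzero-product : ∀ k {f : Fin k → Carrier} → (∀ j → f j ≉ 0#) → prod f ≉ 0#
      nonzero-product zero _ = 1≉0
      nonzero-product (suc k) f≉0 = *-nonzero (f≉0 F.zero) (nonzero-product k (λ j → f≉0 (F.suc j)))

module FiniteField (R : CommutativeRing 0ℓ 0ℓ) (field-R : IsField R)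
                   (N' : ℕ) (card : HasCard R (suc N')) where

  open CommutativeRing R
  open RingFacts R
  open FieldFacts R field-R
  open Enumerations R
  open import Relation.Binary.Reasoning.Setoid setoid
  open import Algebra.Properties.Semiring.Mult semiring using (_×_; ×1-homo-*)
  open import Algebra.Properties.Ring ring using (+-cancelˡ; +-inverseˡ-unique)
  open import Data.Nat as ℕ using (ℕ; zero; suc)
  open import Data.Fin as F using (Fin)
  import Data.Fin.Properties as Fₚ
  open import Data.Product using (∃-syntax; _,_; proj₁; proj₂)
  open import Data.Sum using (_⊎_; inj₁; inj₂)
  open import Data.Unit using (⊤; tt)
  open import Data.Empty using (⊥-elim)
  open import Relation.Nullary using (¬_; Dec; yes; no)
  import Relation.Binary.PropositionalEquality as Eq

  all-elements : Enumerates (suc N') (λ _ → ⊤)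
  all-elements = record
    { elem = proj₁ card
    ; elem∈ = λ _ → tt
    ; elem-injective = proj₁ (proj₂ card)
    ; elem-onto = λ z _ → proj₂ (proj₂ card) z
    }

  open Enumerates all-elements

  index : Carrier → Fin (suc N')
  index z = proj₁ (elem-onto z tt)

  elem-index : ∀ z → elem (index z) ≈ z
  elem-index z = proj₂ (elem-onto z tt)

  -- equality is decided by comparing positions
  infix 4 _≈?_
  _≈?_ : ∀ x y → Dec (x ≈ y)
  x ≈? y with index x Fₚ.≟ index y
  ... | yes same = yes (trans (sym (elem-index x)) (trans (reflexive (Eq.cong elem same)) (elem-index y)))
  ... | no differ = no λ x≈y → differ (elem-injective _ _ (trans (elem-index x) (trans x≈y (sym (elem-index y)))))

  -- summing all elements before and after the shift z ↦ z + 1 shows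
  -- that (N' + 1) · 1 ≈ 0
  card×1≈0 : suc N' × 1# ≈ 0#
  card×1≈0 = sym (+-cancelˡ (sum elem) _ _ (begin
    sum elem + 0#                       ≈⟨ +-identityʳ _ ⟩
    sum elem                            ≈⟨ sum-invariant (suc N') elem _ elem∈ elem-injective elem-onto
                                             (_+ 1#) (λ _ _ → tt) (λ z z' → +-cancelʳ 1# z z') ⟩
    sum {suc N'} (λ i → elem i + 1#)    ≈⟨ ∑-distrib-+ elem (λ _ → 1#) ⟩
    sum elem + sum {suc N'} (λ _ → 1#) ≈⟨ +-congˡ (sum-replicate (suc N')) ⟩
    sum elem + suc N' × 1#              ∎))
    where
    open import Algebra.Properties.CommutativeMonoid.Sum +-commutativeMonoid using (sum; ∑-distrib-+; sum-replicate)
    open Counting.InvariantSum +-commutativeMonoid using (sum-invariant)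
    open import Algebra.Properties.Ring ring using (+-cancelʳ)

  power-characteristic : ∀ p K → suc N' Eq.≡ p ℕ.^ K → p × 1# ≈ 0#
  power-characteristic p K card≡p^K = kill K (trans (reflexive (Eq.cong (_× 1#) (Eq.sym card≡p^K))) card×1≈0)
    where
    -- p ^ (K + 1) · 1 ≈ (p · 1)(p ^ K · 1) and there are no zero divisors
    kill : ∀ K → (p ℕ.^ K) × 1# ≈ 0# → p × 1# ≈ 0#
    kill zero 1≈0 = ⊥-elim (1≉0 (trans (sym (+-identityʳ 1#)) 1≈0))
    kill (suc K) p^K+1≈0 with (p ℕ.^ K) × 1# ≈? 0#
    ... | yes p^K≈0 = kill K p^K≈0
    ... | no p^K≉0 with p × 1# ≈? 0#
    ...   | yes p≈0 = p≈0
    ...   | no p≉0 = ⊥-elim (*-nonzero p≉0 p^K≉0 (trans (sym (×1-homo-* p (p ℕ.^ K))) p^K+1≈0))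

  ≈-stable : ∀ x y → ¬ (x ≉ y) → x ≈ y
  ≈-stable x y ¬x≉y with x ≈? y
  ... | yes x≈y = x≈y
  ... | no x≉y = ⊥-elim (¬x≉y x≉y)

  square-root-of-1 : ∀ c → c * c ≈ 1# → c ≈ 1# ⊎ c ≈ - 1#
  square-root-of-1 c c²≈1 with c + 1# ≈? 0#
  ... | yes c+1≈0 = inj₂ (+-inverseˡ-unique c 1# c+1≈0)
  ... | no c+1≉0 = inj₁ (cancel (c + 1#) c+1≉0 (begin
    (c + 1#) * c    ≈⟨ distribʳ c c 1# ⟩
    c * c + 1# * c  ≈⟨ +-cong c²≈1 (*-identityˡ c) ⟩
    1# + c          ≈⟨ +-comm _ _ ⟩
    c + 1#          ≈⟨ *-identityʳ _ ⟨
    (c + 1#) * 1#   ∎))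

  module Cyclic (γ : Carrier) (γ-order : HasOrder R γ N') where

    open import Data.Nat using (_<_; NonZero)
    import Data.Nat.Properties as ℕₚ
    open import Data.Nat.Divisibility using (_∣_; divides; *-cancelʳ-∣)
    open import Data.Product using (_×_)

    discrete-log : ∀ z → z ≉ 0# → ∃[ a ] (a < N' × pow R γ a ≈ z)
    discrete-log z z≉0 with injective⇒onto (remove-zero all-elements tt) (λ t → pow R γ (F.toℕ t))
                              (λ t → tt , pow-nonzero (F.toℕ t) (order-nonzero γ-order))
                              (λ t t' eq → Fₚ.toℕ-injective (pow-injective γ-order (Fₚ.toℕ<n t) (Fₚ.toℕ<n t') eq))
                              z (tt , z≉0)
    ... | t , γ^t≈z = F.toℕ t , Fₚ.toℕ<n t , γ^t≈z

    pow-order : ∀ z → z ≉ 0# → pow R z N' ≈ 1#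
    pow-order z z≉0 with discrete-log z z≉0
    ... | a , _ , γ^a≈z = begin
      pow R z N'               ≈⟨ pow-cong N' γ^a≈z ⟨
      pow R (pow R γ a) N'     ≈⟨ pow-* γ a N' ⟨
      pow R γ (a ℕ.* N')       ≈⟨ pow-multiple γ N' a (proj₁ (proj₂ γ-order)) ⟩
      1#                       ∎

    roots-of-unity : ∀ d D → d ℕ.* D Eq.≡ N' → Enumerates d (λ z → pow R z d ≈ 1#)
    roots-of-unity d D dD≡N' = record
      { elem = root
      ; elem∈ = root-is-root
      ; elem-injective = λ t t' eq → Fₚ.toℕ-injective (ℕₚ.*-cancelʳ-≡ _ _ D
          (pow-injective γ-order (exponent<N' t) (exponent<N' t') eq))
      ; elem-onto = onto
      }
      where
      instance
        dD-nonzero : NonZero (d ℕ.* D)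
        dD-nonzero = Eq.subst NonZero (Eq.sym dD≡N') (ℕ.>-nonZero (proj₁ γ-order))
        d-nonzero : NonZero d
        d-nonzero = ℕₚ.m*n≢0⇒m≢0 d
        D-nonzero : NonZero D
        D-nonzero = ℕₚ.m*n≢0⇒n≢0 d
      root : Fin d → Carrier
      root t = pow R γ (F.toℕ t ℕ.* D)
      exponent<N' : ∀ (t : Fin d) → F.toℕ t ℕ.* D < N'
      exponent<N' t = Eq.subst (F.toℕ t ℕ.* D <_) dD≡N' (ℕₚ.*-monoˡ-< D (Fₚ.toℕ<n t))
      root-is-root : ∀ t → pow R (root t) d ≈ 1#
      root-is-root t = begin
        pow R (root t) d                   ≈⟨ pow-* γ (F.toℕ t ℕ.* D) d ⟨
        pow R γ (F.toℕ t ℕ.* D ℕ.* d)      ≡⟨ Eq.cong (pow R γ) (Eq.trans (ℕₚ.*-assoc (F.toℕ t) D d)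
                                                  (Eq.cong (F.toℕ t ℕ.*_) (Eq.trans (ℕₚ.*-comm D d) dD≡N'))) ⟩
        pow R γ (F.toℕ t ℕ.* N')           ≈⟨ pow-multiple γ N' (F.toℕ t) (proj₁ (proj₂ γ-order)) ⟩
        1#                                 ∎
      -- z = γ ^ a with N' ∣ a · d forces D ∣ a
      onto : ∀ z → pow R z d ≈ 1# → ∃[ t ] (root t ≈ z)
      onto z z^d≈1 with discrete-log z (root-of-unity-nonzero d z^d≈1)
      ... | a , a<N' , γ^a≈z with *-cancelʳ-∣ d {{d-nonzero}}
             (Eq.subst (_∣ a ℕ.* d) (Eq.trans (Eq.sym dD≡N') (ℕₚ.*-comm d D))
               (order-divides (a ℕ.* d) γ-order (trans (pow-* γ a d) (trans (pow-cong d γ^a≈z) z^d≈1))))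
      ...   | divides t a≡tD = F.fromℕ< t<d , trans (reflexive (Eq.cong (pow R γ)
                  (Eq.trans (Eq.cong (ℕ._* D) (Fₚ.toℕ-fromℕ< t<d)) (Eq.sym a≡tD)))) γ^a≈z
        where
        t<d : t < d
        t<d = ℕₚ.*-cancelʳ-< D t d (Eq.subst₂ _<_ a≡tD (Eq.sym dD≡N') a<N')

    -- adjoining 0: the d + 1 solutions of z ^ (d + 1) ≈ z (a subfield when
    -- d + 1 is a prime power)
    subfield : ∀ d D → d ℕ.* D Eq.≡ N' → Enumerates (suc d) (λ z → pow R z (suc d) ≈ z)
    subfield d D dD≡N' = record
      { elem = element
      ; elem∈ = element∈
      ; elem-injective = injective
      ; elem-onto = onto
      }
      where
      open Enumerates (roots-of-unity d D dD≡N') renaming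
        (elem to root; elem∈ to root∈; elem-injective to root-injective; elem-onto to root-onto)
      root-nonzero : ∀ t → root t ≉ 0#
      root-nonzero t = root-of-unity-nonzero d {{ℕ.>-nonZero (ℕₚ.≤-<-trans ℕ.z≤n (Fₚ.toℕ<n t))}} (root∈ t)
      element : Fin (suc d) → Carrier
      element F.zero = 0#
      element (F.suc t) = root t
      element∈ : ∀ i → pow R (element i) (suc d) ≈ element i
      element∈ F.zero = pow-0# d
      element∈ (F.suc t) = trans (*-congˡ (root∈ t)) (*-identityʳ _)
      injective : ∀ i j → element i ≈ element j → i Eq.≡ j
      injective F.zero F.zero _ = Eq.refl
      injective F.zero (F.suc t) 0≈root = ⊥-elim (root-nonzero t (sym 0≈root))
      injective (F.suc t) F.zero root≈0 = ⊥-elim (root-nonzero t root≈0)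
      injective (F.suc t) (F.suc t') eq = Eq.cong F.suc (root-injective t t' eq)
      onto : ∀ z → pow R z (suc d) ≈ z → ∃[ i ] (element i ≈ z)
      onto z z^d+1≈z with z ≈? 0#
      ... | yes z≈0 = F.zero , sym z≈0
      ... | no z≉0 = F.suc (proj₁ root-z) , proj₂ root-z
        where
        root-z = root-onto z (cancel z z≉0 (trans z^d+1≈z (sym (*-identityʳ z))))

    power-of-element-of-order : ∀ d D → d ℕ.* D Eq.≡ N' → ∀ h → HasOrder R h d →
      ∀ c → pow R c d ≈ 1# → ∃[ j ] (pow R h j ≈ c)
    power-of-element-of-order d D dD≡N' h h-order c c^d≈1 = F.toℕ (proj₁ hit) , proj₂ hit
      where
      power-is-root : ∀ (j : Fin d) → pow R (pow R h (F.toℕ j)) d ≈ 1#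
      power-is-root j = begin
        pow R (pow R h (F.toℕ j)) d  ≈⟨ pow-* h (F.toℕ j) d ⟨
        pow R h (F.toℕ j ℕ.* d)      ≈⟨ pow-multiple h d (F.toℕ j) (proj₁ (proj₂ h-order)) ⟩
        1#                           ∎
      hit : ∃[ j ] (pow R h (F.toℕ j) ≈ c)
      hit = injective⇒onto (roots-of-unity d D dD≡N') (λ j → pow R h (F.toℕ j)) power-is-root
        (λ i j eq → Fₚ.toℕ-injective (pow-injective h-order (Fₚ.toℕ<n i) (Fₚ.toℕ<n j) eq)) c c^d≈1

-- An F_q-subspace of dimension n has exactly q ^ n elements: the vectors
-- are the linear combinations of a basis, indexed by coefficient tuples in
-- Fin n → Fin q ≅ Fin (q ^ n) via an enumeration of the scalars F_q.
module Subspaces (R : CommutativeRing 0ℓ 0ℓ) (q : ℕ)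
                 (scalars : Enumerations.Enumerates R q (InSub R q))
                 (scalar-sub : ∀ a b → InSub R q a → InSub R q b → InSub R q (CommutativeRing._-_ R a b)) where

  open CommutativeRing R
  open RingFacts R
  open Enumerations R
  open import Relation.Binary.Reasoning.Setoid setoid
  open import Algebra.Properties.Ring ring using ([y-z]x≈yx-zx)
  open import Data.Nat using (zero; _^_)
  open import Data.Fin as F using (Fin; funToFin; finToFun)
  import Data.Fin.Properties as Fₚ
  open import Data.Product using (∃-syntax; _,_; proj₁; proj₂)
  import Relation.Binary.PropositionalEquality as Eq

  open Enumerates scalars renaming
    (elem to scalar; elem∈ to scalar∈; elem-injective to scalar-injective; elem-onto to scalar-onto)

  funToFin-cong : ∀ {m k} {f g : Fin m → Fin k} → (∀ i → f i Eq.≡ g i) → funToFin f Eq.≡ funToFin g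
  funToFin-cong {zero} f≗g = Eq.refl
  funToFin-cong {suc m} f≗g = Eq.cong₂ F.combine (f≗g F.zero) (funToFin-cong (λ i → f≗g (F.suc i)))

  span-enumeration : ∀ n W → HasDim R q n W → Enumerates (q ^ n) W
  span-enumeration n W ((_ , W0 , W+ , W*) , basis , basis∈ , independent , spanning) = record
    { elem = vector
    ; elem∈ = λ i → combination∈ n _ (λ j → W* _ _ (scalar∈ (coordinates i j)) (basis∈ j))
    ; elem-injective = injective
    ; elem-onto = onto
    }
    where
    coordinates : Fin (q ^ n) → Fin n → Fin q
    coordinates = finToFun

    vector : Fin (q ^ n) → Carrier
    vector i = sumF R n (λ j → scalar (coordinates i j) * basis j)

    combination∈ : ∀ m (f : Fin m → Carrier) → (∀ j → W (f j)) → W (sumF R m f)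
    combination∈ zero f _ = W0
    combination∈ (suc m) f f∈W = W+ _ _ (f∈W F.zero) (combination∈ m _ (λ j → f∈W (F.suc j)))

    injective : ∀ i i' → vector i ≈ vector i' → i Eq.≡ i'
    injective i i' vi≈vi' = Eq.trans (Eq.sym (Fₚ.funToFin-finToFin {n} {q} i))
      (Eq.trans (funToFin-cong same-coefficient) (Fₚ.funToFin-finToFin {n} {q} i'))
      where
      difference : Fin n → Carrier
      difference j = scalar (coordinates i j) - scalar (coordinates i' j)
      combination≈0 : sumF R n (λ j → difference j * basis j) ≈ 0#
      combination≈0 = begin
        sumF R n (λ j → difference j * basis j)   ≈⟨ sumF-cong n (λ j → [y-z]x≈yx-zx (basis j) _ _) ⟩
        sumF R n (λ j → scalar (coordinates i j) * basis j - scalar (coordinates i' j) * basis j) ≈⟨ sumF-sub n _ _ ⟨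
        vector i - vector i'                       ≈⟨ +-congʳ vi≈vi' ⟩
        vector i' - vector i'                      ≈⟨ -‿inverseʳ _ ⟩
        0#                                         ∎
      same-coefficient : ∀ j → coordinates i j Eq.≡ coordinates i' j
      same-coefficient j = scalar-injective _ _ (begin
        scalar (coordinates i j)                                    ≈⟨ +-identityʳ _ ⟨
        scalar (coordinates i j) + 0#                               ≈⟨ +-congˡ (-‿inverseˡ _) ⟨
        scalar (coordinates i j) + (- scalar (coordinates i' j) + scalar (coordinates i' j)) ≈⟨ +-assoc _ _ _ ⟨
        difference j + scalar (coordinates i' j)                    ≈⟨ +-congʳ (independent difference
                                                                      (λ k → scalar-sub _ _ (scalar∈ _) (scalar∈ _)) combination≈0 j) ⟩
        0# + scalar (coordinates i' j)                              ≈⟨ +-identityˡ _ ⟩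
        scalar (coordinates i' j)                                   ∎)

    onto : ∀ x → W x → ∃[ i ] (vector i ≈ x)
    onto x x∈W = funToFin index , trans (sumF-cong n same-term) (sym x≈combination)
      where
      coefficient = proj₁ (spanning x x∈W)
      x≈combination = proj₂ (proj₂ (spanning x x∈W))
      index : Fin n → Fin q
      index j = proj₁ (scalar-onto (coefficient j) (proj₁ (proj₂ (spanning x x∈W)) j))
      same-term : ∀ j → scalar (coordinates (funToFin index) j) * basis j ≈ coefficient j * basis j
      same-term j = *-congʳ (trans (reflexive (Eq.cong scalar (Fₚ.finToFun-funToFin index j)))
        (proj₂ (scalar-onto (coefficient j) _)))

-- Components of a spread that share a nonzero vector coincide; hence a
-- multiplication Θ(g) in Aut(S) that moves one nonzero vector of a
-- component W back into W stabilises W.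
module Spreads (R : CommutativeRing 0ℓ 0ℓ) where

  open CommutativeRing R
  open import Data.Product using (_,_; proj₁; proj₂)

  automorphism-stabilises : ∀ {q n I comp} → IsSpread R q n I comp →
    ∀ g → MulInAut R g I comp → ∀ w s t → comp w s → comp w t → t ≉ 0# → g * s ≈ t →
    ∀ z → comp w z → comp w (g * z)
  automorphism-stabilises (_ , _ , disjoint) g (image-component , _) w s t s∈W t∈W t≉0 gs≈t z z∈W =
    proj₁ (gW=W (g * z)) (proj₁ (gW=image (g * z)) (z , z∈W , refl))
    where
    -- gW is a component, and it contains t
    image = proj₁ (image-component w)
    gW=image = proj₂ (image-component w)
    gW=W = disjoint t image w t≉0 (proj₁ (gW=image t) (s , s∈W , sym gs≈t)) t∈W

-- The heart of Lemma 3.5, with the exponents normalised: q = p ^ k = 2f + 1,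
-- Q = q ^ n = Q₁ + 1, the field has Q² = Q₁ (Q₁ + 2) + 1 elements, γ is a
-- primitive element and β has order (Q + 1)(q - 1).
module Lemma3p5Argument
  (R : CommutativeRing 0ℓ 0ℓ) (field-R : IsField R)
  (p e k : ℕ) (p-prime : Prime p) (p-odd : p ≡ suc (e Nat.+ e))
  (q f n Q₁ : ℕ) (q≡p^k : q ≡ p Nat.^ k) (q-odd : q ≡ suc (f Nat.+ f)) (q^n≡Q : q Nat.^ n ≡ suc Q₁)
  (card : HasCard R (suc (Q₁ Nat.* suc (suc Q₁))))
  (γ : CommutativeRing.Carrier R) (γ-order : HasOrder R γ (Q₁ Nat.* suc (suc Q₁)))
  (β : CommutativeRing.Carrier R) (β-order : HasOrder R β (suc (suc Q₁) Nat.* (f Nat.+ f)))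
  (I : Set) (comp : I → Pred R) (spread : IsSpread R q n I comp)
  (aut : ∀ k → MulInAut R (pow R β (2 Nat.* k)) I comp) where

  open CommutativeRing R
  open RingFacts R
  open FieldFacts R field-R
  open Enumerations R
  open Spreads R
  open import Relation.Binary.Reasoning.Setoid setoid
  open import Algebra.Properties.Ring ring using (+-cancelˡ; +-cancelʳ; -‿+-comm; -1*x≈-x; -‿distribʳ-*)
  import Data.Nat as ℕ
  import Data.Nat.Properties as ℕₚ
  open import Data.Nat.Tactic.RingSolver using (solve-∀)
  open import Data.Product using (∃-syntax; _×_; _,_; proj₁; proj₂)
  open import Data.Sum using (_⊎_; inj₁; inj₂; [_,_]′)
  open import Data.Empty using (⊥)
  import Relation.Binary.PropositionalEquality as Eq
  open import Relation.Nullary using (Dec; yes; no; ¬?)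
  open import Relation.Nullary.Decidable using (_×-dec_)
  open import Data.Fin.Properties using (any?)

  Q N' : ℕ
  Q = suc Q₁
  N' = Q₁ ℕ.* suc Q

  open FiniteField R field-R N' card
  open Cyclic γ γ-order

  -- the field has Q · Q = p ^ (k · 2n) elements, so characteristic p
  card≡p^ : suc N' Eq.≡ p ℕ.^ (k ℕ.* (2 ℕ.* n))
  card≡p^ = Eq.trans (Eq.sym (Arithmetic.square-power q n Q₁ q^n≡Q))
    (Eq.trans (Eq.cong (ℕ._^ (2 ℕ.* n)) q≡p^k) (ℕₚ.^-*-assoc p k (2 ℕ.* n)))

  open Characteristic p p-prime (power-characteristic p (k ℕ.* (2 ℕ.* n)) card≡p^)

  q-additive : Additive q
  q-additive = Eq.subst Additive (Eq.sym q≡p^k) (frobenius^ k)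

  Q-additive : Additive Q
  Q-additive = Eq.subst Additive (Eq.trans (Eq.sym (ℕₚ.^-*-assoc p k n)) (Eq.trans (Eq.cong (ℕ._^ n) (Eq.sym q≡p^k)) q^n≡Q))
    (frobenius^ (k ℕ.* n))

  instance
    q-nonzero : ℕ.NonZero q
    q-nonzero = Eq.subst ℕ.NonZero (Eq.sym q-odd) _

  -- F_q is the set of solutions of z ^ q ≈ z; (q - 1) divides N'
  scalars : Enumerates q (InSub R q)
  scalars = Eq.subst (λ m → Enumerates m (InSub R m)) (Eq.sym q-odd)
    (subfield (f ℕ.+ f) (G ℕ.* suc Q) (Eq.trans (Eq.sym (ℕₚ.*-assoc (f ℕ.+ f) G (suc Q)))
      (Eq.cong (ℕ._* suc Q) (Eq.sym Q₁≡))))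
    where
    G = proj₁ (Arithmetic.geometric (f ℕ.+ f) n)
    Q₁≡ : Q₁ Eq.≡ (f ℕ.+ f) ℕ.* G
    Q₁≡ = ℕₚ.suc-injective (Eq.trans (Eq.sym q^n≡Q) (Eq.trans (Eq.cong (ℕ._^ n) q-odd)
      (proj₂ (Arithmetic.geometric (f ℕ.+ f) n))))

  component-cong : ∀ w x y → x ≈ y → comp w x → comp w y
  component-cong w = proj₁ (proj₁ (proj₁ spread w))

  component-0 : ∀ w → comp w 0#
  component-0 w = proj₁ (proj₂ (proj₁ (proj₁ spread w)))

  component-+ : ∀ w x y → comp w x → comp w y → comp w (x + y)
  component-+ w = proj₁ (proj₂ (proj₂ (proj₁ (proj₁ spread w))))

  component-scale : ∀ w a x → InSub R q a → comp w x → comp w (a * x)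
  component-scale w = proj₂ (proj₂ (proj₂ (proj₁ (proj₁ spread w))))

  component-enumeration : ∀ i → Enumerates Q (comp i)
  component-enumeration i = Eq.subst (λ m → Enumerates m (comp i)) q^n≡Q
    (Subspaces.span-enumeration R q scalars (additive-sub q q-additive) n (comp i) (proj₁ spread i))

  self-negative⇒0 : ∀ u → u ≈ - u → u ≈ 0#
  self-negative⇒0 u u≈-u = double≈0 e p-odd u (trans (+-congʳ u≈-u) (-‿inverseˡ u))

  -- the two degenerate cases c ≈ 1 and c ≈ -1 of no-mixed-component below
  sum≈difference⇒0 : ∀ x u → x + u ≈ x - u → u ≈ 0#
  sum≈difference⇒0 x u x+u≈x-u = self-negative⇒0 u (+-cancelˡ x u (- u) x+u≈x-u)

  difference≈-sum⇒0 : ∀ x u → x - u ≈ - (x + u) → x ≈ 0#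
  difference≈-sum⇒0 x u x-u≈-[x+u] =
    self-negative⇒0 x (+-cancelʳ (- u) x (- x) (trans x-u≈-[x+u] (sym (-‿+-comm x u))))

  -- elements of norm one, c ^ (Q + 1) ≈ 1, are even powers of β:
  -- c = (β ^ (q - 1)) ^ j = β ^ (2 · f j)
  norm-one⇒even-power-of-β : ∀ c → pow R c (suc Q) ≈ 1# → ∃[ k ] (pow R β (2 ℕ.* k) ≈ c)
  norm-one⇒even-power-of-β c c^Q+1≈1 = f ℕ.* j , (begin
    pow R β (2 ℕ.* (f ℕ.* j))      ≡⟨ Eq.cong (pow R β) (double-product f j) ⟩
    pow R β ((f ℕ.+ f) ℕ.* j)      ≈⟨ pow-* β (f ℕ.+ f) j ⟩
    pow R (pow R β (f ℕ.+ f)) j    ≈⟨ proj₂ root ⟩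
    c                              ∎)
    where
    root = power-of-element-of-order (suc Q) Q₁ (ℕₚ.*-comm (suc Q) Q₁) (pow R β (f ℕ.+ f))
      (order-of-power (suc Q) (f ℕ.+ f) β-order) c c^Q+1≈1
    j : ℕ
    j = proj₁ root
    double-product : ∀ f j → 2 ℕ.* (f ℕ.* j) Eq.≡ (f ℕ.+ f) ℕ.* j
    double-product = solve-∀

  -- -1 ∈ F_q, so components are closed under negation
  component-neg : ∀ w u → comp w u → comp w (- u)
  component-neg w u u∈W = component-cong w _ _ (-1*x≈-x u) (component-scale w (- 1#) u -1∈F_q u∈W)
    where
    -1∈F_q : InSub R q (- 1#)
    -1∈F_q = trans (additive-neg q q-additive 1#) (-‿cong (pow-1# q))

  -- Otherwise c = (x + u) ^ (Q - 1) has norm one and maps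
  -- x + u ∈ W to (x + u) ^ Q = x - u ∈ W, so Θ(c) ∈ ⟨Θ(β²)⟩ stabilises W;
  -- hence c ^ (Q - 1) ≈ 1 as well, so c ≈ ±1, forcing u ≈ 0 or x ≈ 0.
  no-mixed-component : ∀ w x u → comp w x → InSub R Q x → x ≉ 0# →
    comp w u → pow R u Q ≈ - u → u ≉ 0# → ⊥
  no-mixed-component w x u x∈W x∈F_Q x≉0 u∈W u^Q≈-u u≉0 = [ c≉1 , c≉-1 ]′ (square-root-of-1 c c²≈1)
    where
    w₁ w₂ : Carrier
    w₁ = x + u
    w₂ = x - u
    w₁^Q≈w₂ : pow R w₁ Q ≈ w₂
    w₁^Q≈w₂ = trans (Q-additive x u) (+-cong x∈F_Q u^Q≈-u)
    w₁≉0 : w₁ ≉ 0#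
    w₁≉0 w₁≈0 = u≉0 (sum≈difference⇒0 x u (trans w₁≈0 (trans (sym (pow-0# Q₁)) (trans (pow-cong Q (sym w₁≈0)) w₁^Q≈w₂))))
    w₂≉0 : w₂ ≉ 0#
    w₂≉0 w₂≈0 = pow-nonzero Q w₁≉0 (trans w₁^Q≈w₂ w₂≈0)
    c : Carrier
    c = pow R w₁ Q₁
    cw₁≈w₂ : c * w₁ ≈ w₂
    cw₁≈w₂ = trans (*-comm _ _) w₁^Q≈w₂
    c-norm-one : pow R c (suc Q) ≈ 1#
    c-norm-one = trans (sym (pow-* w₁ Q₁ (suc Q))) (pow-order w₁ w₁≉0)
    exponent : ℕ
    exponent = proj₁ (norm-one⇒even-power-of-β c c-norm-one)
    β^2e≈c : pow R β (2 ℕ.* exponent) ≈ c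
    β^2e≈c = proj₂ (norm-one⇒even-power-of-β c c-norm-one)
    c-stabilises : ∀ z → comp w z → comp w (c * z)
    c-stabilises z z∈W = component-cong w _ _ (*-congʳ β^2e≈c)
      (automorphism-stabilises {q = q} {n = n} spread _ (aut exponent) w w₁ w₂
        (component-+ w x u x∈W u∈W) (component-+ w x (- u) x∈W (component-neg w u u∈W))
        w₂≉0 (trans (*-congʳ β^2e≈c) cw₁≈w₂) z z∈W)
    c^Q₁≈1 : pow R c Q₁ ≈ 1#
    c^Q₁≈1 = stabiliser-order Q₁ (component-enumeration w) (component-0 w) c (root-of-unity-nonzero (suc Q) c-norm-one) c-stabilises
    c²≈1 : c * c ≈ 1#
    c²≈1 = begin
      c * c                   ≈⟨ *-congˡ (*-identityʳ c) ⟨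
      c * (c * 1#)            ≈⟨ *-congˡ (*-congˡ c^Q₁≈1) ⟨
      c * (c * pow R c Q₁)    ≈⟨ c-norm-one ⟩
      1#                      ∎
    c≉1 : c ≉ 1#
    c≉1 c≈1 = u≉0 (sum≈difference⇒0 x u (sym (trans (sym cw₁≈w₂) (trans (*-congʳ c≈1) (*-identityˡ w₁)))))
    c≉-1 : c ≉ - 1#
    c≉-1 c≈-1 = x≉0 (difference≈-sum⇒0 x u (trans (sym cw₁≈w₂) (trans (*-congʳ c≈-1) (-1*x≈-x w₁))))

  anti-fixed : ∀ δ → pow R δ Q₁ ≈ - 1# → ∀ y → InSub R Q y → pow R (y * δ) Q ≈ - (y * δ)
  anti-fixed δ δ^Q₁≈-1 y y∈F_Q = begin
    pow R (y * δ) Q          ≈⟨ pow-distrib y δ Q ⟩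
    pow R y Q * (δ * pow R δ Q₁) ≈⟨ *-cong y∈F_Q (*-congˡ δ^Q₁≈-1) ⟩
    y * (δ * - 1#)           ≈⟨ *-congˡ (trans (*-comm δ _) (-1*x≈-x δ)) ⟩
    y * - δ                  ≈⟨ -‿distribʳ-* y δ ⟨
    - (y * δ)                ∎

  -- Either W ∩ F_Q = {0}, or W contains a nonzero x ∈ F_Q, and then
  -- W ∩ F_Q δ = {0} by no-mixed-component; which case holds is decided
  -- by running through the finitely many vectors of W.
  conclusion : ∀ w δ → pow R δ Q₁ ≈ - 1# →
    (∀ x → comp w x → InSub R Q x → x ≈ 0#) ⊎
    (∀ x → comp w x → ∃[ y ] (InSub R Q y × x ≈ y * δ) → x ≈ 0#)
  conclusion w δ δ^Q₁≈-1 = decide (any? λ i → (pow R (elem i) Q ≈? elem i) ×-dec ¬? (elem i ≈? 0#))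
    where
    open Enumerates (component-enumeration w)
    decide : Dec (∃[ i ] (InSub R Q (elem i) × elem i ≉ 0#)) →
      (∀ x → comp w x → InSub R Q x → x ≈ 0#) ⊎
      (∀ x → comp w x → ∃[ y ] (InSub R Q y × x ≈ y * δ) → x ≈ 0#)
    decide (yes (i , fixed , nonzero)) = inj₂ λ u u∈W (y , y∈F_Q , u≈yδ) → ≈-stable u 0# λ u≉0 →
      no-mixed-component w (elem i) u (elem∈ i) fixed nonzero u∈W
        (trans (pow-cong Q u≈yδ) (trans (anti-fixed δ δ^Q₁≈-1 y y∈F_Q) (-‿cong (sym u≈yδ)))) u≉0
    decide (no none) = inj₁ λ x x∈W x∈F_Q → ≈-stable x 0# λ x≉0 →
      let (i , elem-i≈x) = elem-onto x x∈W in
      none (i , trans (pow-cong Q elem-i≈x) (trans x∈F_Q (sym elem-i≈x)) , λ elem-i≈0 → x≉0 (trans (sym elem-i≈x) elem-i≈0))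

open import Defs
open import Level using (0ℓ)
open import Algebra.Bundles using (CommutativeRing)
open import Data.Nat using (ℕ; _≤_; _∸_; _+_; _*_; _^_)
open import Data.Product using (Σ; ∃; ∃-syntax; _×_; _,_)
open import Data.Sum using (_⊎_)

lemma3p5 : (q n : ℕ) → OddPrimePower q → 2 ≤ n →
  (R : CommutativeRing 0ℓ 0ℓ) → IsField R → HasCard R (q ^ (2 * n)) →
  (β γ : CommutativeRing.Carrier R) →
  HasOrder R β ((q ^ n + 1) * (q ∸ 1)) →
  HasOrder R γ (q ^ (2 * n) ∸ 1) →
  (I : Set) → (comp : I → Pred R) → IsSpread R q n I comp →
  KernelIsFq R q I comp →
  ((k : ℕ) → MulInAut R (pow R β (2 * k)) I comp) →
  (w : I) → (δ : CommutativeRing.Carrier R) →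
  CommutativeRing._≈_ R (pow R δ (q ^ n ∸ 1)) (CommutativeRing.-_ R (CommutativeRing.1# R)) →
  ((x : CommutativeRing.Carrier R) → comp w x → InSub R (q ^ n) x →
    CommutativeRing._≈_ R x (CommutativeRing.0# R))
  ⊎
  ((x : CommutativeRing.Carrier R) → comp w x →
    (∃[ y ] (InSub R (q ^ n) y × CommutativeRing._≈_ R x (CommutativeRing._*_ R y δ))) →
    CommutativeRing._≈_ R x (CommutativeRing.0# R))
lemma3p5 q n (p , k , p-prime , p≢2 , _ , q≡p^k) _ R field-R card β γ β-order γ-order I comp spread _ aut w δ δ^Q₁≈-1 =
  Eq.subst Conclusion (Eq.sym q^n≡Q)
    (Lemma3p5Argument.conclusion R field-R p e k p-prime p-odd q f n Q₁ q≡p^k q-odd q^n≡Q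
      (Eq.subst (HasCard R) card≡ card) γ (Eq.subst (HasOrder R γ) (Eq.cong (_∸ 1) card≡) γ-order)
      β (Eq.subst (HasOrder R β) β-order≡ β-order) I comp spread aut w δ δ^Q₁≈-1)
  where
  open CommutativeRing R using (_≈_; 0#) renaming (_*_ to _·_)
  open import Data.Product using (proj₁; proj₂)
  import Relation.Binary.PropositionalEquality as Eq
  import Data.Nat.Properties as ℕₚ
  e f : ℕ
  e = proj₁ (Arithmetic.odd-prime p p-prime p≢2)
  f = proj₁ (Arithmetic.odd-power e k)
  p-odd : p Eq.≡ suc (e + e)
  p-odd = proj₂ (Arithmetic.odd-prime p p-prime p≢2)
  q-odd : q Eq.≡ suc (f + f)
  q-odd = Eq.trans q≡p^k (Eq.trans (Eq.cong (_^ k) p-odd) (proj₂ (Arithmetic.odd-power e k)))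
  Q₁ : ℕ
  Q₁ = q ^ n ∸ 1
  q^n≡Q : q ^ n Eq.≡ suc Q₁
  q^n≡Q = Eq.sym (ℕₚ.suc-pred (q ^ n) {{ℕₚ.m^n≢0 q n {{Eq.subst Nat.NonZero (Eq.sym q-odd) _}}}})
  card≡ : q ^ (2 * n) Eq.≡ suc (Q₁ * suc (suc Q₁))
  card≡ = Arithmetic.square-power q n Q₁ q^n≡Q
  β-order≡ : (q ^ n + 1) * (q ∸ 1) Eq.≡ suc (suc Q₁) * (f + f)
  β-order≡ = Eq.cong₂ _*_ (Eq.trans (ℕₚ.+-comm (q ^ n) 1) (Eq.cong suc q^n≡Q)) (Eq.cong (_∸ 1) q-odd)
  Conclusion : ℕ → Set
  Conclusion Q = ((x : _) → comp w x → InSub R Q x → x ≈ 0#) ⊎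
                 ((x : _) → comp w x → ∃[ y ] (InSub R Q y × x ≈ y · δ) → x ≈ 0#)
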